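{- For odd $n\ge3$ let $g_n(x_1,\dots,x_n)=\mathrm{sgn}\big(2(x_1+\cdots+x_{n-3})+x_{n-2}+x_{n-1}+x_n\big)$. For every odd $n\ge5$, $W^{(1)}[g_n]<W^{(1)}[\mathrm{Maj}_n]$.
   Context: $\mathrm{sgn}(z)=1$ if $z\ge0$ and $-1$ if $z<0$; for odd $n$, $\mathrm{Maj}_n(\mathbf{x})=\mathrm{sgn}(x_1+\cdots+x_n)$. The Fourier coefficients of $f:\{ -1,1\}^n\to\{ -1,1\}$ are $\hat f(S)=2^{ -n}\sum_{\mathbf{x}\in\{ -1,1\}^n} f(\mathbf{x})\prod_{i\in S}x_i$ for $S\subseteq[n]$, and $W^{(1)}[f]=\sum_{i=1}^n\hat f(\{i\})^2$. -}

module Defs where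

open import Data.Bool using (Bool; true; false; if_then_else_)
open import Data.Nat as ℕ using (ℕ; zero; suc; _∸_; _^_)
open import Data.Nat.Properties using (m^n≢0)
open import Data.Integer as ℤ using (ℤ; +_; -_)
open import Data.Fin using (Fin; toℕ)
open import Data.Fin.Subset using (Subset; ⁅_⁆)
open import Data.Vec using (Vec; []; _∷_; lookup)
open import Data.List using (List; []; _∷_; concatMap; map; sum; allFin)
open import Data.Rational as ℚ using (ℚ)
open import Relation.Nullary.Decidable using (does)

sgn : ℤ → ℤ
sgn z = if does (+ 0 ℤ.≤? z) then + 1 else - (+ 1)

cube : (n : ℕ) → List (Vec ℤ n)
cube zero = [] ∷ []
cube (suc n) = concatMap (λ v → (+ 1 ∷ v) ∷ (- (+ 1) ∷ v) ∷ []) (cube n)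

χ : ∀ {n} → Subset n → Vec ℤ n → ℤ
χ [] [] = + 1
χ (true ∷ S) (x ∷ xs) = x ℤ.* χ S xs
χ (false ∷ S) (x ∷ xs) = χ S xs

sumℤ : List ℤ → ℤ
sumℤ [] = + 0
sumℤ (x ∷ xs) = x ℤ.+ sumℤ xs

sumℚ : List ℚ → ℚ
sumℚ [] = ℚ.0ℚ
sumℚ (x ∷ xs) = x ℚ.+ sumℚ xs

fourier : ∀ {n} → (Vec ℤ n → ℤ) → Subset n → ℚ
fourier {n} f S =
  sumℤ (map (λ x → f x ℤ.* χ S x) (cube n)) ℚ./ (2 ^ n) where
  instance _ = m^n≢0 2 n

W1 : ∀ {n} → (Vec ℤ n → ℤ) → ℚ
W1 {n} f = sumℚ (map (λ i → fourier f ⁅ i ⁆ ℚ.* fourier f ⁅ i ⁆) (allFin n))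

sumVec : ∀ {n} → Vec ℤ n → ℤ
sumVec [] = + 0
sumVec (x ∷ xs) = x ℤ.+ sumVec xs

Maj : (n : ℕ) → Vec ℤ n → ℤ
Maj n x = sgn (sumVec x)

-- g_n(x) = sgn(2(x_1+...+x_{n-3}) + x_{n-2} + x_{n-1} + x_n)
-- (coordinate i, 0-indexed, gets weight 2 iff i < n - 3)
g : (n : ℕ) → Vec ℤ n → ℤ
g n x = sgn (sumℤ (map (λ i → weight i ℤ.* lookup x i) (allFin n)))
  where
  weight : Fin n → ℤ
  weight i = if does (suc (toℕ i) ℕ.≤? n ∸ 3) then + 2 else + 1

-- Maj and g are threshold functions sgn (w · x) with weights w ∈ {1, 2}ⁿ. Summing out a coordinate of
-- weight d turns the offset function F into T d F = F (· + d) + F (· − d), or into Δ d F = F (· + d) − F (· − d)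
-- if the coordinate is the one the coefficient is taken at; these operators commute, so 2ⁿ f̂({i}) is a word in
-- them applied to sgn and evaluated at 0. With Δ₁ sgn = 2 (δ₀ + δ₀ (· + 1)), Δ₂ = T₁ Δ₁, T₁² = T₂ + 2 and
-- T₂ʲ F (2y) = T₁ʲ (F ∘ 2·) y every coefficient becomes a binomial coefficient: for n = m + 3 with m even and
-- C = (m choose m/2), Maj has n coefficients 2 (m+2 choose m/2+1) = 8 (m+1) C / (m+2), while g has m coefficients
-- 8C and three coefficients 4C. Multiplied by (m+2)², the inequality 16 (4m+3) C² < 64 (m+3) (m+1)² C² / (m+2)²
-- has slack 16 m² C².

module Submission where

open import Defs
open import Data.Nat using (ℕ; _≤_; _%_)
open import Data.Rational using (_<_)
open import Relation.Binary.PropositionalEquality using (_≡_)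

open import Data.Bool using (true; false; if_then_else_)
open import Data.Fin using (Fin; zero; suc; toℕ; _↑ˡ_; _↑ʳ_)
open import Data.Fin.Subset using (Subset; ⁅_⁆; ⊥)
open import Data.Integer as ℤ using (ℤ; +_; +[1+_]; -[1+_]; _+_; _-_; -_; _*_; +≤+; +<+)
open import Data.Integer.Properties
open import Algebra.Properties.CommutativeSemigroup +-commutativeSemigroup using (interchange)
open import Data.Integer.Tactic.RingSolver using (solve-∀)
open import Data.List using (List; []; _∷_; map; concatMap; allFin; tabulate)
open import Data.List.Properties using (map-tabulate)
import Data.Nat as ℕ
import Data.Nat.DivMod as ℕ
import Data.Nat.Properties as ℕₚ
import Data.Nat.Tactic.RingSolver as ℕ-Solver
open import Data.Product using (∃; _,_)
import Data.Rational as ℚ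
open import Data.Rational using (toℚᵘ)
import Data.Rational.Properties as ℚₚ
open import Data.Rational.Unnormalised using (mkℚᵘ; _≃_; *≡*; *<*)
import Data.Rational.Unnormalised.Properties as ℚᵘₚ
open import Data.Vec using (Vec; []; _∷_; replicate; _++_; lookup)
open import Data.Vec.Properties using (lookup-replicate)
open import Relation.Binary.PropositionalEquality using (refl; sym; trans; cong; cong₂; subst; subst₂; module ≡-Reasoning)
open import Relation.Nullary.Decidable using (does)
open ≡-Reasoning

interchange-− : ∀ a b c d → (a - b) + (c - d) ≡ (a + c) - (b + d)
interchange-− = solve-∀

sumℤ-map-cong : ∀ {A : Set} {F G : A → ℤ} (xs : List A) → (∀ x → F x ≡ G x) →
                sumℤ (map F xs) ≡ sumℤ (map G xs)
sumℤ-map-cong []       F≗G = refl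
sumℤ-map-cong (x ∷ xs) F≗G = cong₂ _+_ (F≗G x) (sumℤ-map-cong xs F≗G)

sumℤ-map-+ : ∀ {A : Set} (F G : A → ℤ) (xs : List A) →
             sumℤ (map (λ x → F x + G x) xs) ≡ sumℤ (map F xs) + sumℤ (map G xs)
sumℤ-map-+ F G []       = refl
sumℤ-map-+ F G (x ∷ xs) =
  trans (cong (_+_ (F x + G x)) (sumℤ-map-+ F G xs)) (interchange (F x) (G x) _ _)

sumℤ-map-− : ∀ {A : Set} (F G : A → ℤ) (xs : List A) →
             sumℤ (map (λ x → F x - G x) xs) ≡ sumℤ (map F xs) - sumℤ (map G xs)
sumℤ-map-− F G []       = refl
sumℤ-map-− F G (x ∷ xs) =
  trans (cong (_+_ (F x - G x)) (sumℤ-map-− F G xs)) (interchange-− (F x) (G x) _ _)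

sumℤ-map-cube-suc : ∀ n (G : Vec ℤ (ℕ.suc n) → ℤ) →
  sumℤ (map G (cube (ℕ.suc n))) ≡ sumℤ (map (λ v → G (+ 1 ∷ v) + G (- + 1 ∷ v)) (cube n))
sumℤ-map-cube-suc n G = go (cube n)
  where
  go : ∀ vs → sumℤ (map G (concatMap (λ v → (+ 1 ∷ v) ∷ (- + 1 ∷ v) ∷ []) vs))
            ≡ sumℤ (map (λ v → G (+ 1 ∷ v) + G (- + 1 ∷ v)) vs)
  go []       = refl
  go (v ∷ vs) = trans (sym (+-assoc (G (+ 1 ∷ v)) _ _)) (cong (_+_ (G (+ 1 ∷ v) + G (- + 1 ∷ v))) (go vs))

fourierNum : ∀ {n} → (Vec ℤ n → ℤ) → Subset n → ℤ
fourierNum {n} f S = sumℤ (map (λ x → f x * χ S x) (cube n))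

fourierNum-cong : ∀ {n} {f f′ : Vec ℤ n → ℤ} (S : Subset n) → (∀ x → f x ≡ f′ x) →
                  fourierNum f S ≡ fourierNum f′ S
fourierNum-cong {n} S f≗f′ = sumℤ-map-cong (cube n) (λ x → cong (_* χ S x) (f≗f′ x))

-- The operators T and Δ

T : ℤ → (ℤ → ℤ) → ℤ → ℤ
T d F c = F (c + d) + F (c - d)

Δ : ℤ → (ℤ → ℤ) → ℤ → ℤ
Δ d F c = F (c + d) - F (c - d)

T-cong : ∀ d {F G : ℤ → ℤ} → (∀ c → F c ≡ G c) → ∀ c → T d F c ≡ T d G c
T-cong d F≗G c = cong₂ _+_ (F≗G (c + d)) (F≗G (c - d))

Δ-cong : ∀ d {F G : ℤ → ℤ} → (∀ c → F c ≡ G c) → ∀ c → Δ d F c ≡ Δ d G c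
Δ-cong d F≗G c = cong₂ _-_ (F≗G (c + d)) (F≗G (c - d))

T^ : ℤ → ℕ → (ℤ → ℤ) → ℤ → ℤ
T^ d ℕ.zero    F = F
T^ d (ℕ.suc j) F = T d (T^ d j F)

T^-cong : ∀ d j {F G : ℤ → ℤ} → (∀ c → F c ≡ G c) → ∀ c → T^ d j F c ≡ T^ d j G c
T^-cong d ℕ.zero    F≗G = F≗G
T^-cong d (ℕ.suc j) F≗G = T-cong d (T^-cong d j F≗G)

T^-+ : ∀ d j (F G : ℤ → ℤ) c → T^ d j (λ y → F y + G y) c ≡ T^ d j F c + T^ d j G c
T^-+ d ℕ.zero    F G c = refl
T^-+ d (ℕ.suc j) F G c =
  trans (cong₂ _+_ (T^-+ d j F G (c + d)) (T^-+ d j F G (c - d)))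
        (interchange (T^ d j F (c + d)) (T^ d j G (c + d)) (T^ d j F (c - d)) (T^ d j G (c - d)))

T^-− : ∀ d j (F G : ℤ → ℤ) c → T^ d j (λ y → F y - G y) c ≡ T^ d j F c - T^ d j G c
T^-− d ℕ.zero    F G c = refl
T^-− d (ℕ.suc j) F G c =
  trans (cong₂ _+_ (T^-− d j F G (c + d)) (T^-− d j F G (c - d)))
        (interchange-− (T^ d j F (c + d)) (T^ d j G (c + d)) (T^ d j F (c - d)) (T^ d j G (c - d)))

T^-* : ∀ d j a (F : ℤ → ℤ) c → T^ d j (λ y → a * F y) c ≡ a * T^ d j F c
T^-* d ℕ.zero    a F c = refl
T^-* d (ℕ.suc j) a F c =
  trans (cong₂ _+_ (T^-* d j a F (c + d)) (T^-* d j a F (c - d))) (sym (*-distribˡ-+ a _ _))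

T^-shift : ∀ d j a (F : ℤ → ℤ) c → T^ d j (λ y → F (y + a)) c ≡ T^ d j F (c + a)
T^-shift d ℕ.zero    a F c = refl
T^-shift d (ℕ.suc j) a F c =
  cong₂ _+_ (trans (T^-shift d j a F (c + d)) (cong (T^ d j F) (swap c d a)))
            (trans (T^-shift d j a F (c - d)) (cong (T^ d j F) (swap c (- d) a)))
  where
  swap : ∀ c d a → c + d + a ≡ c + a + d
  swap = solve-∀

T^-Δ : ∀ d j e (F : ℤ → ℤ) c → Δ e (T^ d j F) c ≡ T^ d j (Δ e F) c
T^-Δ d j e F c = sym (trans (T^-− d j (λ y → F (y + e)) (λ y → F (y - e)) c)
                            (cong₂ _-_ (T^-shift d j e F c) (T^-shift d j (- e) F c)))

T^-T^ : ∀ d j i (F : ℤ → ℤ) c → T^ d j (T^ d i F) c ≡ T^ d (j ℕ.+ i) F c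
T^-T^ d ℕ.zero    i F c = refl
T^-T^ d (ℕ.suc j) i F c = T-cong d (T^-T^ d j i F) c

T^-double : ∀ d j (F : ℤ → ℤ) y → T^ (d + d) j F (y + y) ≡ T^ d j (λ z → F (z + z)) y
T^-double d ℕ.zero    F y = refl
T^-double d (ℕ.suc j) F y =
  cong₂ _+_ (trans (cong (T^ (d + d) j F) (double⁺ y d)) (T^-double d j F (y + d)))
            (trans (cong (T^ (d + d) j F) (double⁻ y d)) (T^-double d j F (y - d)))
  where
  double⁺ : ∀ y d → y + y + (d + d) ≡ (y + d) + (y + d)
  double⁺ = solve-∀
  double⁻ : ∀ y d → y + y - (d + d) ≡ (y - d) + (y - d)
  double⁻ = solve-∀

i+j-j≡i : ∀ i j → i + j - j ≡ i
i+j-j≡i = solve-∀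

i-j+j≡i : ∀ i j → i - j + j ≡ i
i-j+j≡i = solve-∀

i-j-j≡i-[j+j] : ∀ i j → i - j - j ≡ i - (j + j)
i-j-j≡i-[j+j] = solve-∀

T-T : ∀ d (F : ℤ → ℤ) c → T d (T d F) c ≡ T (d + d) F c + + 2 * F c
T-T d F c = begin
  (F (c + d + d) + F (c + d - d)) + (F (c - d + d) + F (c - d - d))
    ≡⟨ cong₂ _+_ (cong₂ _+_ (cong F (+-assoc c d d)) (cong F (i+j-j≡i c d)))
                 (cong₂ _+_ (cong F (i-j+j≡i c d)) (cong F (i-j-j≡i-[j+j] c d))) ⟩
  (F (c + (d + d)) + F c) + (F c + F (c - (d + d)))
    ≡⟨ regroup (F (c + (d + d))) (F c) (F (c - (d + d))) ⟩
  T (d + d) F c + + 2 * F c ∎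
  where
  regroup : ∀ a b e → (a + b) + (b + e) ≡ (a + e) + + 2 * b
  regroup = solve-∀

Δ-double : ∀ d (F : ℤ → ℤ) c → Δ (d + d) F c ≡ T d (Δ d F) c
Δ-double d F c = begin
  F (c + (d + d)) - F (c - (d + d))
    ≡⟨ +-minus-telescope (F (c + (d + d))) (F c) (F (c - (d + d))) ⟨
  (F (c + (d + d)) - F c) + (F c - F (c - (d + d)))
    ≡⟨ cong₂ _+_ (cong₂ _-_ (cong F (sym (+-assoc c d d))) (cong F (sym (i+j-j≡i c d))))
                 (cong₂ _-_ (cong F (sym (i-j+j≡i c d))) (cong F (sym (i-j-j≡i-[j+j] c d)))) ⟩
  T d (Δ d F) c ∎

Δ₂-T^₁³ : ∀ (F : ℤ → ℤ) y →
  Δ (+ 2) (T^ (+ 1) 3 F) y ≡ T^ (+ 2) 2 (Δ (+ 1) F) y + + 4 * T (+ 2) (Δ (+ 1) F) y + + 4 * Δ (+ 1) F y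
Δ₂-T^₁³ F y = begin
  Δ (+ 2) (T^ (+ 1) 3 F) y        ≡⟨ T^-Δ (+ 1) 3 (+ 2) F y ⟩
  T^ (+ 1) 3 (Δ (+ 2) F) y        ≡⟨ T^-cong (+ 1) 3 (Δ-double (+ 1) F) y ⟩
  T^ (+ 1) 3 (T^ (+ 1) 1 G) y     ≡⟨ T^-T^ (+ 1) 3 1 G y ⟩
  T^ (+ 1) 2 (T^ (+ 1) 2 G) y     ≡⟨ T^-cong (+ 1) 2 (T-T (+ 1) G) y ⟩
  T^ (+ 1) 2 R y                  ≡⟨ T-T (+ 1) R y ⟩
  T (+ 2) R y + + 2 * R y         ≡⟨ expand (T (+ 2) G (y + + 2)) (T (+ 2) G (y - + 2)) (G (y + + 2)) (G (y - + 2)) (G y) ⟩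
  T^ (+ 2) 2 G y + + 4 * T (+ 2) G y + + 4 * G y ∎
  where
  G R : ℤ → ℤ
  G = Δ (+ 1) F
  R z = T (+ 2) G z + + 2 * G z
  expand : ∀ a b c d e → (a + + 2 * c) + (b + + 2 * d) + + 2 * ((c + d) + + 2 * e)
                         ≡ (a + b) + + 4 * (c + d) + + 4 * e
  expand = solve-∀

-- Fourier coefficients of threshold functions

dot : ∀ {n} → Vec ℤ n → Vec ℤ n → ℤ
dot []       []       = + 0
dot (w ∷ ws) (x ∷ xs) = w * x + dot ws xs

coeff : ∀ {n} → (ℤ → ℤ) → Vec ℤ n → Subset n → ℤ → ℤ
coeff F w S c = fourierNum (λ x → F (c + dot w x)) S

cubeSum : ∀ {n} → (ℤ → ℤ) → Vec ℤ n → ℤ → ℤ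
cubeSum F w = coeff F w ⊥

coeff-[] : ∀ F c → coeff F [] [] c ≡ F c
coeff-[] F c = trans (+-identityʳ _) (trans (*-identityʳ _) (cong F (+-identityʳ c)))

coeff-∷ : ∀ {n} F d (w : Vec ℤ n) b S c →
  coeff F (d ∷ w) (b ∷ S) c ≡ (if b then Δ d else T d) (coeff F w S) c
coeff-∷ {n} F d w b S c = begin
  coeff F (d ∷ w) (b ∷ S) c
    ≡⟨ sumℤ-map-cube-suc n _ ⟩
  sumℤ (map (λ v → F (c + (d * + 1 + dot w v)) * χ (b ∷ S) (+ 1 ∷ v)
                 + F (c + (d * - + 1 + dot w v)) * χ (b ∷ S) (- + 1 ∷ v)) (cube n))
    ≡⟨ sumℤ-map-cong (cube n) (summand b) ⟩
  sumℤ (map (λ v → (if b then _-_ else _+_) (term (c + d) v) (term (c - d) v)) (cube n))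
    ≡⟨ split b ⟩
  (if b then Δ d else T d) (coeff F w S) c ∎
  where
  term : ℤ → Vec ℤ n → ℤ
  term e v = F (e + dot w v) * χ S v
  shift⁺ : ∀ c d t → c + (d * + 1 + t) ≡ c + d + t
  shift⁺ = solve-∀
  shift⁻ : ∀ c d t → c + (d * - + 1 + t) ≡ c - d + t
  shift⁻ = solve-∀
  summand : ∀ b v → F (c + (d * + 1 + dot w v)) * χ (b ∷ S) (+ 1 ∷ v)
                  + F (c + (d * - + 1 + dot w v)) * χ (b ∷ S) (- + 1 ∷ v)
                  ≡ (if b then _-_ else _+_) (term (c + d) v) (term (c - d) v)
  summand false v rewrite shift⁺ c d (dot w v) | shift⁻ c d (dot w v) = refl
  summand true  v rewrite shift⁺ c d (dot w v) | shift⁻ c d (dot w v) =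
    cong₂ _+_ (cong (F (c + d + dot w v) *_) (*-identityˡ (χ S v)))
              (trans (cong (F (c - d + dot w v) *_) (-1*i≡-i (χ S v)))
                     (sym (neg-distribʳ-* (F (c - d + dot w v)) (χ S v))))
  split : ∀ b → sumℤ (map (λ v → (if b then _-_ else _+_) (term (c + d) v) (term (c - d) v)) (cube n))
              ≡ (if b then Δ d else T d) (coeff F w S) c
  split false = sumℤ-map-+ (term (c + d)) (term (c - d)) (cube n)
  split true  = sumℤ-map-− (term (c + d)) (term (c - d)) (cube n)

⊥-++ : ∀ m k → ⊥ {m} ++ ⊥ {k} ≡ ⊥
⊥-++ ℕ.zero    k = refl
⊥-++ (ℕ.suc m) k = cong (false ∷_) (⊥-++ m k)

⁅↑ˡ⁆ : ∀ {m} (i : Fin m) k → ⁅ i ↑ˡ k ⁆ ≡ ⁅ i ⁆ ++ ⊥ {k}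
⁅↑ˡ⁆ {ℕ.suc m} zero    k = cong (true ∷_) (sym (⊥-++ m k))
⁅↑ˡ⁆           (suc i) k = cong (false ∷_) (⁅↑ˡ⁆ i k)

⁅↑ʳ⁆ : ∀ m {k} (i : Fin k) → ⁅ m ↑ʳ i ⁆ ≡ ⊥ {m} ++ ⁅ i ⁆
⁅↑ʳ⁆ ℕ.zero    i = refl
⁅↑ʳ⁆ (ℕ.suc m) i = cong (false ∷_) (⁅↑ʳ⁆ m i)

coeff-++ : ∀ {m k} F (u : Vec ℤ m) (v : Vec ℤ k) S S′ c →
           coeff F (u ++ v) (S ++ S′) c ≡ coeff (coeff F v S′) u S c
coeff-++ F []      v []      S′ c = sym (coeff-[] (coeff F v S′) c)
coeff-++ F (d ∷ u) v (b ∷ S) S′ c = begin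
  coeff F (d ∷ (u ++ v)) (b ∷ (S ++ S′)) c                ≡⟨ coeff-∷ F d (u ++ v) b (S ++ S′) c ⟩
  (if b then Δ d else T d) (coeff F (u ++ v) (S ++ S′)) c ≡⟨ step-cong b (coeff-++ F u v S S′) ⟩
  (if b then Δ d else T d) (coeff (coeff F v S′) u S) c   ≡⟨ coeff-∷ (coeff F v S′) d u b S c ⟨
  coeff (coeff F v S′) (d ∷ u) (b ∷ S) c                  ∎
  where
  step-cong : ∀ b {G H : ℤ → ℤ} → (∀ c → G c ≡ H c) →
              (if b then Δ d else T d) G c ≡ (if b then Δ d else T d) H c
  step-cong false G≗H = T-cong d G≗H c
  step-cong true  G≗H = Δ-cong d G≗H c

cubeSum-replicate : ∀ k d F c → cubeSum F (replicate k d) c ≡ T^ d k F c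
cubeSum-replicate ℕ.zero    d F c = coeff-[] F c
cubeSum-replicate (ℕ.suc k) d F c =
  trans (coeff-∷ F d (replicate k d) false ⊥ c) (T-cong d (cubeSum-replicate k d F) c)

coeff-replicate-⁅⁆ : ∀ k d F (i : Fin (ℕ.suc k)) c →
                     coeff F (replicate (ℕ.suc k) d) ⁅ i ⁆ c ≡ T^ d k (Δ d F) c
coeff-replicate-⁅⁆ k d F zero c = begin
  coeff F (d ∷ replicate k d) (true ∷ ⊥) c ≡⟨ coeff-∷ F d (replicate k d) true ⊥ c ⟩
  Δ d (cubeSum F (replicate k d)) c       ≡⟨ Δ-cong d (cubeSum-replicate k d F) c ⟩
  Δ d (T^ d k F) c                        ≡⟨ T^-Δ d k d F c ⟩
  T^ d k (Δ d F) c                        ∎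
coeff-replicate-⁅⁆ (ℕ.suc k) d F (suc i) c =
  trans (coeff-∷ F d (replicate (ℕ.suc k) d) false ⁅ i ⁆ c)
        (T-cong d (coeff-replicate-⁅⁆ k d F i) c)

-- Binomial coefficients

δ₀ : ℤ → ℤ
δ₀ (+ ℕ.zero) = + 1
δ₀ +[1+ n ]   = + 0
δ₀ -[1+ n ]   = + 0

-- H j c counts the x ∈ {−1,1}ʲ with x₁ + ⋯ + x_j = −c: a binomial coefficient
H : ℕ → ℤ → ℤ
H j = T^ (+ 1) j δ₀

H-parity : ∀ j c t → c + + j ≡ t + t + + 1 → H j c ≡ + 0
H-parity ℕ.zero c t c≡2t+1 = trans (cong δ₀ (trans (sym (+-identityʳ c)) c≡2t+1)) (δ₀-odd t)
  where
  δ₀-odd : ∀ t → δ₀ (t + t + + 1) ≡ + 0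
  δ₀-odd (+ n)     rewrite ℕₚ.+-comm (n ℕ.+ n) 1 = refl
  δ₀-odd -[1+ n ] = refl
H-parity (ℕ.suc j) c t c+j+1≡2t+1 = cong₂ _+_
  (H-parity j (c + + 1) t (trans (step⁺ c (+ j)) c+j+1≡2t+1))
  (H-parity j (c - + 1) (t - + 1) (trans (step⁻ c (+ j)) (trans (cong (_- + 2) c+j+1≡2t+1) (odd⁻ t))))
  where
  step⁺ : ∀ c j → c + + 1 + j ≡ c + (+ 1 + j)
  step⁺ = solve-∀
  step⁻ : ∀ c j → c - + 1 + j ≡ c + (+ 1 + j) - + 2
  step⁻ = solve-∀
  odd⁻ : ∀ t → t + t + + 1 - + 2 ≡ (t - + 1) + (t - + 1) + + 1
  odd⁻ = solve-∀

H-sym : ∀ j c → H j (- c) ≡ H j c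
H-sym ℕ.zero (+ ℕ.zero) = refl
H-sym ℕ.zero +[1+ n ]   = refl
H-sym ℕ.zero -[1+ n ]   = refl
H-sym (ℕ.suc j) c = begin
  H j (- c + + 1) + H j (- c - + 1) ≡⟨ cong₂ _+_ (cong (H j) (neg⁺ c)) (cong (H j) (neg⁻ c)) ⟩
  H j (- (c - + 1)) + H j (- (c + + 1)) ≡⟨ cong₂ _+_ (H-sym j (c - + 1)) (H-sym j (c + + 1)) ⟩
  H j (c - + 1) + H j (c + + 1)         ≡⟨ +-comm (H j (c - + 1)) (H j (c + + 1)) ⟩
  H j (c + + 1) + H j (c - + 1)         ∎
  where
  neg⁺ : ∀ c → - c + + 1 ≡ - (c - + 1)
  neg⁺ = solve-∀
  neg⁻ : ∀ c → - c - + 1 ≡ - (c + + 1)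
  neg⁻ = solve-∀

H-nonNeg : ∀ j c → + 0 ℤ.≤ H j c
H-nonNeg ℕ.zero    (+ ℕ.zero) = +≤+ ℕ.z≤n
H-nonNeg ℕ.zero    +[1+ n ]   = +≤+ ℕ.z≤n
H-nonNeg ℕ.zero    -[1+ n ]   = +≤+ ℕ.z≤n
H-nonNeg (ℕ.suc j) c          = +-mono-≤ (H-nonNeg j (c + + 1)) (H-nonNeg j (c - + 1))

H-even-pos : ∀ k → + 1 ℤ.≤ H (k ℕ.+ k) (+ 0)
H-even-pos ℕ.zero    = ≤-refl
H-even-pos (ℕ.suc k) rewrite ℕₚ.+-suc k k = ≤-trans (H-even-pos k) (H-grows (k ℕ.+ k))
  where
  -- H (j + 2) 0 = (H j 2 + H j 0) + (H j 0 + H j (−2)), all four terms non-negative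
  H-grows : ∀ j → H j (+ 0) ℤ.≤ H (ℕ.suc (ℕ.suc j)) (+ 0)
  H-grows j = subst (ℤ._≤ H (ℕ.suc (ℕ.suc j)) (+ 0)) (trans (+-identityʳ _) (+-identityˡ _))
    (+-mono-≤ (+-mono-≤ (H-nonNeg j (+ 2)) (≤-refl {H j (+ 0)}))
              (+-mono-≤ (H-nonNeg j (+ 0)) (H-nonNeg j (- + 2))))

H-ratio : ∀ j c → (+ j + c + + 2) * H j (c + + 2) ≡ (+ j - c) * H j c
H-ratio ℕ.zero c = begin
  (+ 0 + c + + 2) * δ₀ (c + + 2) ≡⟨ cong (λ x → (x + + 2) * δ₀ (c + + 2)) (+-identityˡ c) ⟩
  (c + + 2) * δ₀ (c + + 2)       ≡⟨ x*δ₀x≡0 (c + + 2) ⟩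
  + 0                            ≡⟨ cong -_ (x*δ₀x≡0 c) ⟨
  - (c * δ₀ c)                   ≡⟨ negate c (δ₀ c) ⟩
  (+ 0 - c) * δ₀ c               ∎
  where
  x*δ₀x≡0 : ∀ x → x * δ₀ x ≡ + 0
  x*δ₀x≡0 (+ ℕ.zero) = refl
  x*δ₀x≡0 +[1+ n ]   = *-zeroʳ +[1+ n ]
  x*δ₀x≡0 -[1+ n ]   = *-zeroʳ -[1+ n ]
  negate : ∀ c h → - (c * h) ≡ (+ 0 - c) * h
  negate = solve-∀
H-ratio (ℕ.suc j) c = begin
  (+ 1 + J + c + + 2) * (H j (c + + 2 + + 1) + H j (c + + 2 - + 1))
    ≡⟨ cong₂ (λ x y → (+ 1 + J + c + + 2) * (H j x + H j y)) (shift⁺ c) (shift⁻ c) ⟩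
  (+ 1 + J + c + + 2) * (H j (c + + 1 + + 2) + H j (c + + 1))
    ≡⟨ split-left J c (H j (c + + 1 + + 2)) (H j (c + + 1)) ⟩
  (J + (c + + 1) + + 2) * H j (c + + 1 + + 2) + (J + c + + 3) * H j (c + + 1)
    ≡⟨ cong (_+ (J + c + + 3) * H j (c + + 1)) (H-ratio j (c + + 1)) ⟩
  (J - (c + + 1)) * H j (c + + 1) + (J + c + + 3) * H j (c + + 1)
    ≡⟨ regroup J c (H j (c + + 1)) ⟩
  (J + (c - + 1) + + 2) * H j (c + + 1) + (+ 1 + J - c) * H j (c + + 1)
    ≡⟨ cong (λ x → (J + (c - + 1) + + 2) * H j x + (+ 1 + J - c) * H j (c + + 1)) (shift⁻′ c) ⟨
  (J + (c - + 1) + + 2) * H j (c - + 1 + + 2) + (+ 1 + J - c) * H j (c + + 1)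
    ≡⟨ cong (_+ (+ 1 + J - c) * H j (c + + 1)) (H-ratio j (c - + 1)) ⟩
  (J - (c - + 1)) * H j (c - + 1) + (+ 1 + J - c) * H j (c + + 1)
    ≡⟨ merge-right J c (H j (c + + 1)) (H j (c - + 1)) ⟩
  (+ 1 + J - c) * (H j (c + + 1) + H j (c - + 1)) ∎
  where
  J = + j
  shift⁺ : ∀ c → c + + 2 + + 1 ≡ c + + 1 + + 2
  shift⁺ = solve-∀
  shift⁻ : ∀ c → c + + 2 - + 1 ≡ c + + 1
  shift⁻ = solve-∀
  shift⁻′ : ∀ c → c - + 1 + + 2 ≡ c + + 1
  shift⁻′ = solve-∀
  split-left : ∀ J c a b → (+ 1 + J + c + + 2) * (a + b) ≡ (J + (c + + 1) + + 2) * a + (J + c + + 3) * b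
  split-left = solve-∀
  regroup : ∀ J c b → (J - (c + + 1)) * b + (J + c + + 3) * b ≡ (J + (c - + 1) + + 2) * b + (+ 1 + J - c) * b
  regroup = solve-∀
  merge-right : ∀ J c b e → (J - (c - + 1)) * e + (+ 1 + J - c) * b ≡ (+ 1 + J - c) * (b + e)
  merge-right = solve-∀

H-ratio-at-0 : ∀ j → (+ j + + 2) * H j (+ 2) ≡ + j * H j (+ 0)
H-ratio-at-0 j = trans (cong (λ x → (x + + 2) * H j (+ 2)) (sym (+-identityʳ (+ j))))
                       (trans (H-ratio j (+ 0)) (cong (_* H j (+ 0)) (+-identityʳ (+ j))))

H-two-steps-at-0 : ∀ j → H (ℕ.suc (ℕ.suc j)) (+ 0) ≡ + 2 * (H j (+ 0) + H j (+ 2))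
H-two-steps-at-0 j = begin
  H (ℕ.suc (ℕ.suc j)) (+ 0)                    ≡⟨ T-T (+ 1) (H j) (+ 0) ⟩
  H j (+ 2) + H j (- + 2) + + 2 * H j (+ 0)    ≡⟨ cong (λ x → H j (+ 2) + x + + 2 * H j (+ 0)) (H-sym j (+ 2)) ⟩
  H j (+ 2) + H j (+ 2) + + 2 * H j (+ 0)      ≡⟨ collect (H j (+ 0)) (H j (+ 2)) ⟩
  + 2 * (H j (+ 0) + H j (+ 2))                ∎
  where
  collect : ∀ a b → b + b + + 2 * a ≡ + 2 * (a + b)
  collect = solve-∀

Δ₁sgn : ∀ c → Δ (+ 1) sgn c ≡ + 2 * (δ₀ c + δ₀ (c + + 1))
Δ₁sgn (+ ℕ.zero)       = refl
Δ₁sgn +[1+ n ]         = refl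
Δ₁sgn -[1+ ℕ.zero ]    = refl
Δ₁sgn -[1+ ℕ.suc n ]   = refl

Δ₁sgn-double : ∀ y → Δ (+ 1) sgn (y + y) ≡ + 2 * δ₀ y
Δ₁sgn-double (+ ℕ.zero) = refl
Δ₁sgn-double +[1+ n ]   = refl
Δ₁sgn-double -[1+ n ]   = refl

T^₁-Δ₁sgn : ∀ j c → T^ (+ 1) j (Δ (+ 1) sgn) c ≡ + 2 * (H j c + H j (c + + 1))
T^₁-Δ₁sgn j c = begin
  T^ (+ 1) j (Δ (+ 1) sgn) c                         ≡⟨ T^-cong (+ 1) j Δ₁sgn c ⟩
  T^ (+ 1) j (λ y → + 2 * (δ₀ y + δ₀ (y + + 1))) c   ≡⟨ T^-* (+ 1) j (+ 2) _ c ⟩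
  + 2 * T^ (+ 1) j (λ y → δ₀ y + δ₀ (y + + 1)) c     ≡⟨ cong (+ 2 *_) (T^-+ (+ 1) j δ₀ _ c) ⟩
  + 2 * (H j c + T^ (+ 1) j (λ y → δ₀ (y + + 1)) c)  ≡⟨ cong (λ x → + 2 * (H j c + x)) (T^-shift (+ 1) j (+ 1) δ₀ c) ⟩
  + 2 * (H j c + H j (c + + 1))                      ∎

T^₂-Δ₁sgn-at-0 : ∀ j → T^ (+ 2) j (Δ (+ 1) sgn) (+ 0) ≡ + 2 * H j (+ 0)
T^₂-Δ₁sgn-at-0 j = begin
  T^ (+ 2) j (Δ (+ 1) sgn) (+ 0)                ≡⟨ T^-double (+ 1) j (Δ (+ 1) sgn) (+ 0) ⟩
  T^ (+ 1) j (λ y → Δ (+ 1) sgn (y + y)) (+ 0)  ≡⟨ T^-cong (+ 1) j Δ₁sgn-double (+ 0) ⟩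
  T^ (+ 1) j (λ y → + 2 * δ₀ y) (+ 0)           ≡⟨ T^-* (+ 1) j (+ 2) δ₀ (+ 0) ⟩
  + 2 * H j (+ 0)                               ∎

T^₂-Δ₂T^₁³sgn-at-0 : ∀ j → T^ (+ 2) j (Δ (+ 2) (T^ (+ 1) 3 sgn)) (+ 0)
                         ≡ + 2 * H (j ℕ.+ 2) (+ 0) + + 8 * H (j ℕ.+ 1) (+ 0) + + 8 * H j (+ 0)
T^₂-Δ₂T^₁³sgn-at-0 j = begin
  T^ (+ 2) j (Δ (+ 2) (T^ (+ 1) 3 sgn)) (+ 0)
    ≡⟨ T^-cong (+ 2) j (Δ₂-T^₁³ sgn) (+ 0) ⟩
  T^ (+ 2) j (λ y → T^ (+ 2) 2 S y + + 4 * T^ (+ 2) 1 S y + + 4 * S y) (+ 0)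
    ≡⟨ T^-+ (+ 2) j _ (λ y → + 4 * S y) (+ 0) ⟩
  T^ (+ 2) j (λ y → T^ (+ 2) 2 S y + + 4 * T^ (+ 2) 1 S y) (+ 0) + T^ (+ 2) j (λ y → + 4 * S y) (+ 0)
    ≡⟨ cong₂ _+_ (T^-+ (+ 2) j (T^ (+ 2) 2 S) (λ y → + 4 * T^ (+ 2) 1 S y) (+ 0)) (T^-* (+ 2) j (+ 4) S (+ 0)) ⟩
  T^ (+ 2) j (T^ (+ 2) 2 S) (+ 0) + T^ (+ 2) j (λ y → + 4 * T^ (+ 2) 1 S y) (+ 0) + + 4 * T^ (+ 2) j S (+ 0)
    ≡⟨ cong (λ x → T^ (+ 2) j (T^ (+ 2) 2 S) (+ 0) + x + + 4 * T^ (+ 2) j S (+ 0)) (T^-* (+ 2) j (+ 4) (T^ (+ 2) 1 S) (+ 0)) ⟩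
  T^ (+ 2) j (T^ (+ 2) 2 S) (+ 0) + + 4 * T^ (+ 2) j (T^ (+ 2) 1 S) (+ 0) + + 4 * T^ (+ 2) j S (+ 0)
    ≡⟨ cong₂ (λ x y → x + + 4 * y + + 4 * T^ (+ 2) j S (+ 0)) (T^-T^ (+ 2) j 2 S (+ 0)) (T^-T^ (+ 2) j 1 S (+ 0)) ⟩
  T^ (+ 2) (j ℕ.+ 2) S (+ 0) + + 4 * T^ (+ 2) (j ℕ.+ 1) S (+ 0) + + 4 * T^ (+ 2) j S (+ 0)
    ≡⟨ cong₂ _+_ (cong₂ (λ x y → x + + 4 * y) (T^₂-Δ₁sgn-at-0 (j ℕ.+ 2)) (T^₂-Δ₁sgn-at-0 (j ℕ.+ 1)))
                 (cong (+ 4 *_) (T^₂-Δ₁sgn-at-0 j)) ⟩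
  + 2 * H (j ℕ.+ 2) (+ 0) + + 4 * (+ 2 * H (j ℕ.+ 1) (+ 0)) + + 4 * (+ 2 * H j (+ 0))
    ≡⟨ collect (H (j ℕ.+ 2) (+ 0)) (H (j ℕ.+ 1) (+ 0)) (H j (+ 0)) ⟩
  + 2 * H (j ℕ.+ 2) (+ 0) + + 8 * H (j ℕ.+ 1) (+ 0) + + 8 * H j (+ 0) ∎
  where
  S = Δ (+ 1) sgn
  collect : ∀ a b c → + 2 * a + + 4 * (+ 2 * b) + + 4 * (+ 2 * c) ≡ + 2 * a + + 8 * b + + 8 * c
  collect = solve-∀

T^₂-T^₁²Δ₁sgn-at-0 : ∀ m → T^ (+ 2) m (T^ (+ 1) 2 (Δ (+ 1) sgn)) (+ 0) ≡ + 2 * H (m ℕ.+ 1) (+ 0) + + 4 * H m (+ 0)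
T^₂-T^₁²Δ₁sgn-at-0 m = begin
  T^ (+ 2) m (T^ (+ 1) 2 S) (+ 0)                          ≡⟨ T^-cong (+ 2) m (T-T (+ 1) S) (+ 0) ⟩
  T^ (+ 2) m (λ y → T^ (+ 2) 1 S y + + 2 * S y) (+ 0)     ≡⟨ T^-+ (+ 2) m (T^ (+ 2) 1 S) (λ y → + 2 * S y) (+ 0) ⟩
  T^ (+ 2) m (T^ (+ 2) 1 S) (+ 0) + T^ (+ 2) m (λ y → + 2 * S y) (+ 0)
    ≡⟨ cong₂ _+_ (T^-T^ (+ 2) m 1 S (+ 0)) (T^-* (+ 2) m (+ 2) S (+ 0)) ⟩
  T^ (+ 2) (m ℕ.+ 1) S (+ 0) + + 2 * T^ (+ 2) m S (+ 0)
    ≡⟨ cong₂ (λ x y → x + + 2 * y) (T^₂-Δ₁sgn-at-0 (m ℕ.+ 1)) (T^₂-Δ₁sgn-at-0 m) ⟩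
  + 2 * H (m ℕ.+ 1) (+ 0) + + 2 * (+ 2 * H m (+ 0))       ≡⟨ cong (_+_ (+ 2 * H (m ℕ.+ 1) (+ 0))) (sym (*-assoc (+ 2) (+ 2) _)) ⟩
  + 2 * H (m ℕ.+ 1) (+ 0) + + 4 * H m (+ 0)               ∎
  where
  S = Δ (+ 1) sgn

-- The degree-1 coefficients of Maj and g

sumVec≡dot-ones : ∀ {n} (x : Vec ℤ n) → sumVec x ≡ dot (replicate n (+ 1)) x
sumVec≡dot-ones []       = refl
sumVec≡dot-ones (x ∷ xs) = cong₂ _+_ (sym (*-identityˡ x)) (sumVec≡dot-ones xs)

sumℤ-weighted≡dot : ∀ {n} (w : Fin n → ℤ) (u x : Vec ℤ n) → (∀ i → w i ≡ lookup u i) →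
                    sumℤ (map (λ i → w i * lookup x i) (allFin n)) ≡ dot u x
sumℤ-weighted≡dot {n} w u x w≗u = trans (cong sumℤ (map-tabulate (λ i → i) (λ i → w i * lookup x i))) (go w u x w≗u)
  where
  go : ∀ {n} (w : Fin n → ℤ) (u x : Vec ℤ n) → (∀ i → w i ≡ lookup u i) →
       sumℤ (tabulate (λ i → w i * lookup x i)) ≡ dot u x
  go w []      []       w≗u = refl
  go w (d ∷ u) (x ∷ xs) w≗u = cong₂ _+_ (cong (_* x) (w≗u zero)) (go (λ i → w (suc i)) u xs (λ i → w≗u (suc i)))

lookup-replicate-++ : ∀ m {k} (a b : ℤ) (i : Fin (m ℕ.+ k)) →
  (if does (ℕ.suc (toℕ i) ℕ.≤? m) then a else b) ≡ lookup (replicate m a ++ replicate k b) i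
lookup-replicate-++ ℕ.zero    a b i       = sym (lookup-replicate i b)
lookup-replicate-++ (ℕ.suc m) a b zero    = refl
lookup-replicate-++ (ℕ.suc m) a b (suc i) = lookup-replicate-++ m a b i

Maj≗sgn-dot : ∀ {n} (x : Vec ℤ n) → Maj n x ≡ sgn (+ 0 + dot (replicate n (+ 1)) x)
Maj≗sgn-dot x = cong sgn (trans (sumVec≡dot-ones x) (sym (+-identityˡ _)))

gWeights : ∀ m → Vec ℤ (m ℕ.+ 3)
gWeights m = replicate m (+ 2) ++ replicate 3 (+ 1)

g≗sgn-dot : ∀ m (x : Vec ℤ (m ℕ.+ 3)) → g (m ℕ.+ 3) x ≡ sgn (+ 0 + dot (gWeights m) x)
g≗sgn-dot m x = cong sgn (trans (sumℤ-weighted≡dot _ (gWeights m) x weight≗gWeights) (sym (+-identityˡ _)))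
  where
  weight≗gWeights : ∀ i → (if does (ℕ.suc (toℕ i) ℕ.≤? m ℕ.+ 3 ℕ.∸ 3) then + 2 else + 1) ≡ lookup (gWeights m) i
  weight≗gWeights i rewrite ℕₚ.m+n∸n≡m m 3 = lookup-replicate-++ m (+ 2) (+ 1) i

fourierNum-Maj : ∀ {n k} → ℕ.suc k ≡ n → (i : Fin n) →
                 fourierNum (Maj n) ⁅ i ⁆ ≡ T^ (+ 1) k (Δ (+ 1) sgn) (+ 0)
fourierNum-Maj {k = k} refl i =
  trans (fourierNum-cong ⁅ i ⁆ Maj≗sgn-dot) (coeff-replicate-⁅⁆ k (+ 1) sgn i (+ 0))

fourierNum-g-weight2 : ∀ j (i : Fin (ℕ.suc j)) →
  fourierNum (g (ℕ.suc j ℕ.+ 3)) ⁅ i ↑ˡ 3 ⁆ ≡ T^ (+ 2) j (Δ (+ 2) (T^ (+ 1) 3 sgn)) (+ 0)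
fourierNum-g-weight2 j i = begin
  fourierNum (g (m ℕ.+ 3)) ⁅ i ↑ˡ 3 ⁆        ≡⟨ fourierNum-cong ⁅ i ↑ˡ 3 ⁆ (g≗sgn-dot m) ⟩
  coeff sgn (gWeights m) ⁅ i ↑ˡ 3 ⁆ (+ 0)    ≡⟨ cong (λ S → coeff sgn (gWeights m) S (+ 0)) (⁅↑ˡ⁆ i 3) ⟩
  coeff sgn (gWeights m) (⁅ i ⁆ ++ ⊥) (+ 0)  ≡⟨ coeff-++ sgn (replicate m (+ 2)) (replicate 3 (+ 1)) ⁅ i ⁆ ⊥ (+ 0) ⟩
  coeff (cubeSum sgn (replicate 3 (+ 1))) (replicate m (+ 2)) ⁅ i ⁆ (+ 0)
    ≡⟨ coeff-replicate-⁅⁆ j (+ 2) (cubeSum sgn (replicate 3 (+ 1))) i (+ 0) ⟩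
  T^ (+ 2) j (Δ (+ 2) (cubeSum sgn (replicate 3 (+ 1)))) (+ 0)
    ≡⟨ T^-cong (+ 2) j (Δ-cong (+ 2) (cubeSum-replicate 3 (+ 1) sgn)) (+ 0) ⟩
  T^ (+ 2) j (Δ (+ 2) (T^ (+ 1) 3 sgn)) (+ 0) ∎
  where
  m = ℕ.suc j

fourierNum-g-weight1 : ∀ m (i : Fin 3) →
  fourierNum (g (m ℕ.+ 3)) ⁅ m ↑ʳ i ⁆ ≡ T^ (+ 2) m (T^ (+ 1) 2 (Δ (+ 1) sgn)) (+ 0)
fourierNum-g-weight1 m i = begin
  fourierNum (g (m ℕ.+ 3)) ⁅ m ↑ʳ i ⁆        ≡⟨ fourierNum-cong ⁅ m ↑ʳ i ⁆ (g≗sgn-dot m) ⟩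
  coeff sgn (gWeights m) ⁅ m ↑ʳ i ⁆ (+ 0)    ≡⟨ cong (λ S → coeff sgn (gWeights m) S (+ 0)) (⁅↑ʳ⁆ m i) ⟩
  coeff sgn (gWeights m) (⊥ ++ ⁅ i ⁆) (+ 0)  ≡⟨ coeff-++ sgn (replicate m (+ 2)) (replicate 3 (+ 1)) ⊥ ⁅ i ⁆ (+ 0) ⟩
  cubeSum (coeff sgn (replicate 3 (+ 1)) ⁅ i ⁆) (replicate m (+ 2)) (+ 0)
    ≡⟨ cubeSum-replicate m (+ 2) (coeff sgn (replicate 3 (+ 1)) ⁅ i ⁆) (+ 0) ⟩
  T^ (+ 2) m (coeff sgn (replicate 3 (+ 1)) ⁅ i ⁆) (+ 0)
    ≡⟨ T^-cong (+ 2) m (coeff-replicate-⁅⁆ 2 (+ 1) sgn i) (+ 0) ⟩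
  T^ (+ 2) m (T^ (+ 1) 2 (Δ (+ 1) sgn)) (+ 0) ∎

fourierNum-Maj-even : ∀ K (i : Fin (K ℕ.+ K ℕ.+ 3)) →
  fourierNum (Maj (K ℕ.+ K ℕ.+ 3)) ⁅ i ⁆ ≡ + 4 * (H (K ℕ.+ K) (+ 0) + H (K ℕ.+ K) (+ 2))
fourierNum-Maj-even K i = begin
  fourierNum (Maj (m ℕ.+ 3)) ⁅ i ⁆                ≡⟨ fourierNum-Maj (ℕₚ.+-comm 3 m) i ⟩
  T^ (+ 1) (2 ℕ.+ m) (Δ (+ 1) sgn) (+ 0)          ≡⟨ T^₁-Δ₁sgn (2 ℕ.+ m) (+ 0) ⟩
  + 2 * (H (2 ℕ.+ m) (+ 0) + H (2 ℕ.+ m) (+ 1))  ≡⟨ cong (λ x → + 2 * (H (2 ℕ.+ m) (+ 0) + x))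
                                                          (H-parity (2 ℕ.+ m) (+ 1) (+ ℕ.suc K) (cong +_ (odd K))) ⟩
  + 2 * (H (2 ℕ.+ m) (+ 0) + + 0)                 ≡⟨ cong (+ 2 *_) (+-identityʳ _) ⟩
  + 2 * H (2 ℕ.+ m) (+ 0)                         ≡⟨ cong (+ 2 *_) (H-two-steps-at-0 m) ⟩
  + 2 * (+ 2 * (H m (+ 0) + H m (+ 2)))           ≡⟨ *-assoc (+ 2) (+ 2) _ ⟨
  + 4 * (H m (+ 0) + H m (+ 2))                   ∎
  where
  m = K ℕ.+ K
  odd : ∀ K → 1 ℕ.+ (2 ℕ.+ (K ℕ.+ K)) ≡ ℕ.suc K ℕ.+ ℕ.suc K ℕ.+ 1
  odd = ℕ-Solver.solve-∀

fourierNum-g-weight2-even : ∀ k (i : Fin (ℕ.suc k ℕ.+ ℕ.suc k)) →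
  fourierNum (g (ℕ.suc k ℕ.+ ℕ.suc k ℕ.+ 3)) ⁅ i ↑ˡ 3 ⁆ ≡ + 8 * H (ℕ.suc k ℕ.+ ℕ.suc k) (+ 0)
fourierNum-g-weight2-even k i = begin
  fourierNum (g (m ℕ.+ 3)) ⁅ i ↑ˡ 3 ⁆                                   ≡⟨ fourierNum-g-weight2 j i ⟩
  T^ (+ 2) j (Δ (+ 2) (T^ (+ 1) 3 sgn)) (+ 0)                          ≡⟨ T^₂-Δ₂T^₁³sgn-at-0 j ⟩
  + 2 * H (j ℕ.+ 2) (+ 0) + + 8 * H (j ℕ.+ 1) (+ 0) + + 8 * H j (+ 0)
    ≡⟨ cong₂ _+_ (cong₂ (λ x y → + 2 * x + + 8 * y)
                        (H-parity (j ℕ.+ 2) (+ 0) (+ ℕ.suc k) (cong +_ (j+2-odd k)))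
                        (cong (λ t → H t (+ 0)) (j+1≡m k)))
                 (cong (+ 8 *_) (H-parity j (+ 0) (+ k) (cong +_ (j-odd k)))) ⟩
  + 2 * + 0 + + 8 * H m (+ 0) + + 8 * + 0                              ≡⟨ drop-zeros (H m (+ 0)) ⟩
  + 8 * H m (+ 0)                                                      ∎
  where
  m = ℕ.suc k ℕ.+ ℕ.suc k
  j = k ℕ.+ ℕ.suc k
  j+2-odd : ∀ k → k ℕ.+ ℕ.suc k ℕ.+ 2 ≡ ℕ.suc k ℕ.+ ℕ.suc k ℕ.+ 1
  j+2-odd = ℕ-Solver.solve-∀
  j+1≡m : ∀ k → k ℕ.+ ℕ.suc k ℕ.+ 1 ≡ ℕ.suc k ℕ.+ ℕ.suc k
  j+1≡m = ℕ-Solver.solve-∀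
  j-odd : ∀ k → k ℕ.+ ℕ.suc k ≡ k ℕ.+ k ℕ.+ 1
  j-odd = ℕ-Solver.solve-∀
  drop-zeros : ∀ x → + 2 * + 0 + + 8 * x + + 8 * + 0 ≡ + 8 * x
  drop-zeros = solve-∀

fourierNum-g-weight1-even : ∀ K (i : Fin 3) →
  fourierNum (g (K ℕ.+ K ℕ.+ 3)) ⁅ (K ℕ.+ K) ↑ʳ i ⁆ ≡ + 4 * H (K ℕ.+ K) (+ 0)
fourierNum-g-weight1-even K i = begin
  fourierNum (g (m ℕ.+ 3)) ⁅ m ↑ʳ i ⁆             ≡⟨ fourierNum-g-weight1 m i ⟩
  T^ (+ 2) m (T^ (+ 1) 2 (Δ (+ 1) sgn)) (+ 0)     ≡⟨ T^₂-T^₁²Δ₁sgn-at-0 m ⟩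
  + 2 * H (m ℕ.+ 1) (+ 0) + + 4 * H m (+ 0)       ≡⟨ cong (λ x → + 2 * x + + 4 * H m (+ 0)) (H-parity (m ℕ.+ 1) (+ 0) (+ K) refl) ⟩
  + 2 * + 0 + + 4 * H m (+ 0)                     ≡⟨ +-identityˡ _ ⟩
  + 4 * H m (+ 0)                                 ∎
  where
  m = K ℕ.+ K

-- Level-1 weight

sumℤ-tabulate-const : ∀ {n} (h : Fin n → ℤ) a → (∀ i → h i ≡ a) → sumℤ (tabulate h) ≡ + n * a
sumℤ-tabulate-const {ℕ.zero}  h a h≡a = sym (*-zeroˡ a)
sumℤ-tabulate-const {ℕ.suc n} h a h≡a = begin
  h zero + sumℤ (tabulate (λ i → h (suc i))) ≡⟨ cong₂ _+_ (h≡a zero) (sumℤ-tabulate-const _ a (λ i → h≡a (suc i))) ⟩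
  a + + n * a                                 ≡⟨ cong (_+ + n * a) (*-identityˡ a) ⟨
  + 1 * a + + n * a                           ≡⟨ *-distribʳ-+ a (+ 1) (+ n) ⟨
  + ℕ.suc n * a                               ∎

sumℤ-tabulate-++ : ∀ m {k} (h : Fin (m ℕ.+ k) → ℤ) →
  sumℤ (tabulate h) ≡ sumℤ (tabulate (λ i → h (i ↑ˡ k))) + sumℤ (tabulate (λ i → h (m ↑ʳ i)))
sumℤ-tabulate-++ ℕ.zero    h = sym (+-identityˡ _)
sumℤ-tabulate-++ (ℕ.suc m) h =
  trans (cong (_+_ (h zero)) (sumℤ-tabulate-++ m (λ i → h (suc i)))) (sym (+-assoc (h zero) _ _))

fourierNum² : ∀ {n} → (Vec ℤ n → ℤ) → Fin n → ℤ
fourierNum² f i = fourierNum f ⁅ i ⁆ * fourierNum f ⁅ i ⁆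

W1-numerator : ∀ {n} → (Vec ℤ n → ℤ) → ℤ
W1-numerator f = sumℤ (tabulate (fourierNum² f))

W1-numerator-Maj-even : ∀ K → let a = + 4 * (H (K ℕ.+ K) (+ 0) + H (K ℕ.+ K) (+ 2)) in
  W1-numerator (Maj (K ℕ.+ K ℕ.+ 3)) ≡ + (K ℕ.+ K ℕ.+ 3) * (a * a)
W1-numerator-Maj-even K =
  sumℤ-tabulate-const (fourierNum² (Maj _)) _ (λ i → cong (λ a → a * a) (fourierNum-Maj-even K i))

W1-numerator-g-even : ∀ k → let m = ℕ.suc k ℕ.+ ℕ.suc k; C = H m (+ 0) in
  W1-numerator (g (m ℕ.+ 3)) ≡ + m * ((+ 8 * C) * (+ 8 * C)) + + 3 * ((+ 4 * C) * (+ 4 * C))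
W1-numerator-g-even k = trans (sumℤ-tabulate-++ (ℕ.suc k ℕ.+ ℕ.suc k) (fourierNum² (g _)))
  (cong₂ _+_ (sumℤ-tabulate-const _ _ (λ i → cong (λ a → a * a) (fourierNum-g-weight2-even k i)))
             (sumℤ-tabulate-const _ _ (λ i → cong (λ a → a * a) (fourierNum-g-weight1-even (ℕ.suc k) i))))

toℚᵘ-/ : ∀ z {D d} → D ≡ ℕ.suc d → .{{_ : ℕ.NonZero D}} → toℚᵘ (z ℚ./ D) ≃ mkℚᵘ z d
toℚᵘ-/ z refl = ℚₚ.toℚᵘ-fromℚᵘ (mkℚᵘ z _)

toℚᵘ-sumℚ-tabulate : ∀ {n} (F : Fin n → ℚ.ℚ) (G : Fin n → ℤ) e → (∀ i → toℚᵘ (F i) ≃ mkℚᵘ (G i) e) →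
                     toℚᵘ (sumℚ (tabulate F)) ≃ mkℚᵘ (sumℤ (tabulate G)) e
toℚᵘ-sumℚ-tabulate {ℕ.zero}  F G e F≃G = *≡* refl
toℚᵘ-sumℚ-tabulate {ℕ.suc n} F G e F≃G =
  ℚᵘₚ.≃-trans (ℚₚ.toℚᵘ-homo-+ (F zero) _)
  (ℚᵘₚ.≃-trans (ℚᵘₚ.+-cong (F≃G zero) (toℚᵘ-sumℚ-tabulate _ _ e (λ i → F≃G (suc i))))
               (*≡* (trans (distrib (G zero) rest (+ ℕ.suc e)) (cong ((G zero + rest) *_) (sym (pos-* (ℕ.suc e) (ℕ.suc e)))))))
  where
  rest = sumℤ (tabulate (λ i → G (suc i)))
  distrib : ∀ x y E → (x * E + y * E) * E ≡ (x + y) * (E * E)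
  distrib = solve-∀

-- ℚᵘ stores a denominator minus one; this one is 4ⁿ − 1
W1-denominator : ℕ → ℕ
W1-denominator n = d ℕ.+ d ℕ.* ℕ.suc d
  where d = ℕ.pred (2 ℕ.^ n)

toℚᵘ-W1 : ∀ {n} (f : Vec ℤ n → ℤ) → toℚᵘ (W1 f) ≃ mkℚᵘ (W1-numerator f) (W1-denominator n)
toℚᵘ-W1 {n} f = ℚᵘₚ.≃-trans (ℚᵘₚ.≃-reflexive (cong (λ qs → toℚᵘ (sumℚ qs)) (map-tabulate (λ i → i) square)))
                            (toℚᵘ-sumℚ-tabulate _ _ (W1-denominator n) toℚᵘ-square)
  where
  instance _ = ℕₚ.m^n≢0 2 n
  square : Fin n → ℚ.ℚ
  square i = fourier f ⁅ i ⁆ ℚ.* fourier f ⁅ i ⁆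
  2ⁿ≡suc : 2 ℕ.^ n ≡ ℕ.suc (ℕ.pred (2 ℕ.^ n))
  2ⁿ≡suc = sym (ℕₚ.suc-pred (2 ℕ.^ n))
  toℚᵘ-square : ∀ i → toℚᵘ (square i) ≃ mkℚᵘ (fourierNum f ⁅ i ⁆ * fourierNum f ⁅ i ⁆) (W1-denominator n)
  toℚᵘ-square i = ℚᵘₚ.≃-trans (ℚₚ.toℚᵘ-homo-* (fourier f ⁅ i ⁆) (fourier f ⁅ i ⁆))
                              (ℚᵘₚ.*-cong (toℚᵘ-/ (fourierNum f ⁅ i ⁆) 2ⁿ≡suc) (toℚᵘ-/ (fourierNum f ⁅ i ⁆) 2ⁿ≡suc))

W1-numerator-<⇒W1-< : ∀ {n} (f f′ : Vec ℤ n → ℤ) → W1-numerator f ℤ.< W1-numerator f′ → W1 f < W1 f′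
W1-numerator-<⇒W1-< {n} f f′ num< =
  ℚₚ.toℚᵘ-cancel-< (ℚᵘₚ.<-respˡ-≃ (ℚᵘₚ.≃-sym (toℚᵘ-W1 f)) (ℚᵘₚ.<-respʳ-≃ (ℚᵘₚ.≃-sym (toℚᵘ-W1 f′))
    (*<* (*-monoʳ-<-pos (+ ℕ.suc (W1-denominator n)) num<))))

level1-gap : ∀ m (C h : ℤ) → + 1 ℤ.≤ C → (+ ℕ.suc m + + 2) * h ≡ + ℕ.suc m * C →
  + ℕ.suc m * ((+ 8 * C) * (+ 8 * C)) + + 3 * ((+ 4 * C) * (+ 4 * C))
    ℤ.< (+ ℕ.suc m + + 3) * ((+ 4 * (C + h)) * (+ 4 * (C + h)))
level1-gap m -[1+ c ]   h ()
level1-gap m (+ ℕ.zero) h (+≤+ ())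
level1-gap m C@(+[1+ c ]) h _ ratio = *-cancelˡ-<-nonNeg (P * P)
  (subst₂ ℤ._<_ (+-identityʳ (P * P * L)) P²L+gap≡P²R (+-monoʳ-< (P * P * L) (+<+ (ℕ.s≤s ℕ.z≤n))))
  where
  M = + ℕ.suc m
  P = M + + 2
  L = M * ((+ 8 * C) * (+ 8 * C)) + + 3 * ((+ 4 * C) * (+ 4 * C))
  R = (M + + 3) * ((+ 4 * (C + h)) * (+ 4 * (C + h)))
  scale : ∀ M C h → (M + + 2) * (M + + 2) * ((M + + 3) * ((+ 4 * (C + h)) * (+ 4 * (C + h))))
                    ≡ + 16 * (M + + 3) * (((M + + 2) * C + (M + + 2) * h) * ((M + + 2) * C + (M + + 2) * h))
  scale = solve-∀
  -- 4 (M + 3)(M + 1)² − (4M + 3)(M + 2)² = M²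
  excess : ∀ M C → + 16 * (M + + 3) * (((M + + 2) * C + M * C) * ((M + + 2) * C + M * C))
                   ≡ (M + + 2) * (M + + 2) * (M * ((+ 8 * C) * (+ 8 * C)) + + 3 * ((+ 4 * C) * (+ 4 * C)))
                     + + 16 * (M * M) * (C * C)
  excess = solve-∀
  P²L+gap≡P²R : P * P * L + + 16 * (M * M) * (C * C) ≡ P * P * R
  P²L+gap≡P²R = begin
    P * P * L + + 16 * (M * M) * (C * C)                     ≡⟨ excess M C ⟨
    + 16 * (M + + 3) * ((P * C + M * C) * (P * C + M * C))   ≡⟨ cong (λ x → + 16 * (M + + 3) * ((P * C + x) * (P * C + x))) ratio ⟨
    + 16 * (M + + 3) * ((P * C + P * h) * (P * C + P * h))   ≡⟨ scale M C h ⟨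
    P * P * R                                                ∎

odd≥5⇒≡2[k+1]+3 : ∀ n → n % 2 ≡ 1 → 5 ≤ n → ∃ λ k → n ≡ ℕ.suc k ℕ.+ ℕ.suc k ℕ.+ 3
odd≥5⇒≡2[k+1]+3 n n%2≡1 5≤n = from-quotient (n ℕ./ 2) (trans (ℕ.m≡m%n+[m/n]*n n 2) (cong (ℕ._+ (n ℕ./ 2) ℕ.* 2) n%2≡1))
  where
  from-quotient : ∀ q → n ≡ 1 ℕ.+ q ℕ.* 2 → ∃ λ k → n ≡ ℕ.suc k ℕ.+ ℕ.suc k ℕ.+ 3
  from-quotient 0 n≡1 with subst (5 ≤_) n≡1 5≤n
  ... | ℕ.s≤s ()
  from-quotient 1 n≡3 with subst (5 ≤_) n≡3 5≤n
  ... | ℕ.s≤s (ℕ.s≤s (ℕ.s≤s ()))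
  from-quotient (ℕ.suc (ℕ.suc k)) n≡2k+5 = k , trans n≡2k+5 (regroup k)
    where
    regroup : ∀ k → 1 ℕ.+ ℕ.suc (ℕ.suc k) ℕ.* 2 ≡ ℕ.suc k ℕ.+ ℕ.suc k ℕ.+ 3
    regroup = ℕ-Solver.solve-∀

lemma4 : ∀ (n : ℕ) → n % 2 ≡ 1 → 5 ≤ n → W1 (g n) < W1 (Maj n)
lemma4 n n%2≡1 5≤n with odd≥5⇒≡2[k+1]+3 n n%2≡1 5≤n
... | k , refl = W1-numerator-<⇒W1-< (g n) (Maj n)
  (subst₂ ℤ._<_ (sym (W1-numerator-g-even k)) (sym (W1-numerator-Maj-even (ℕ.suc k)))
    (level1-gap (k ℕ.+ ℕ.suc k) _ _ (H-even-pos (ℕ.suc k)) (H-ratio-at-0 (ℕ.suc k ℕ.+ ℕ.suc k))))
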